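{- For all conditional propositions $W,X,Y,Z$ and every finite (possibly empty) sequence $\Gamma$: if $\vdash\lfloor\Gamma|W\leftrightarrow X\rfloor$ and $\vdash\lfloor\Gamma|Y\leftrightarrow Z\rfloor$ then $\vdash\lfloor\Gamma|[W]Y\leftrightarrow[X]Z\rfloor$.
   Context: $\mathcal{C}$: smallest set containing $\bot$ and a set of atoms, closed under $X\to Y$ and $[X]Y$; $\neg X:=X\to\bot$, $X\vee Y:=\neg X\to Y$, $X\wedge Y:=\neg(\neg X\vee\neg Y)$, $\top:=\neg\bot$, $X\leftrightarrow Y:=(X\to Y)\wedge(Y\to X)$. Bayesian propositions $\lfloor X_1|\cdots|X_n\rfloor$ ($n\ge1$); $\Gamma,\Delta$ finite possibly empty sequences, $\lfloor\Gamma|X\rfloor$ appending. Proof system: axioms $\lfloor A\rfloor$ for instances over $\mathcal{C}$ of a standard Hilbert system for classical propositional logic; $\lfloor[X](Y\to Z)\to([X]Y\to[X]Z)\rfloor$; $\lfloor[X]Y\to(X\to Y)\rfloor$; $\lfloor[X]\neg Y\leftrightarrow\neg[X]Y\rfloor$. Rules: from $\lfloor\Gamma|X\rfloor$, $\lfloor\Delta|X\to Y\rfloor$ infer $\lfloor\Gamma|\Delta|Y\rfloor$; permutation of components; from $\lfloor\Gamma|X|X\rfloor$ infer $\lfloor\Gamma|X\rfloor$; from $\lfloor\Gamma\rfloor$ infer $\lfloor\Gamma|X\rfloor$; from $\lfloor\Gamma|X\to Y\rfloor$ infer $\lfloor\Gamma|\neg X|[X]Y\rfloor$; from $\lfloor\Gamma|Y\leftrightarrow\neg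 X\rfloor$, $\lfloor\Gamma|[X]Z\leftrightarrow Z\rfloor$ infer $\lfloor\Gamma|[Y]Z\leftrightarrow Z\rfloor$. $\vdash$ means derivable. -}

module Defs where

open import Data.List using (List; []; _∷_; _++_; [_])
open import Data.List.Relation.Binary.Permutation.Propositional using (_↭_)

data Cond (A : Set) : Set where
  atom : A → Cond A
  ⊥c   : Cond A
  _⇒_  : Cond A → Cond A → Cond A
  ⟦_⟧_ : Cond A → Cond A → Cond A

infixr 5 _⇒_
infixr 6 ⟦_⟧_

module _ {A : Set} where
  ¬c_ : Cond A → Cond A
  ¬c X = X ⇒ ⊥c

  _∨c_ : Cond A → Cond A → Cond A
  X ∨c Y = (¬c X) ⇒ Y

  _∧c_ : Cond A → Cond A → Cond A
  X ∧c Y = ¬c ((¬c X) ∨c (¬c Y))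

  ⊤c : Cond A
  ⊤c = ¬c ⊥c

  _⇔_ : Cond A → Cond A → Cond A
  X ⇔ Y = (X ⇒ Y) ∧c (Y ⇒ X)

  data PropAxiom : Cond A → Set where
    ax-K : ∀ X Y → PropAxiom (X ⇒ (Y ⇒ X))
    ax-S : ∀ X Y Z → PropAxiom ((X ⇒ (Y ⇒ Z)) ⇒ ((X ⇒ Y) ⇒ (X ⇒ Z)))
    ax-C : ∀ X Y → PropAxiom (((¬c X) ⇒ (¬c Y)) ⇒ (Y ⇒ X))

  -- Bayesian propositions ⌊X₁|⋯|Xₙ⌋ represented as lists of conditional
  -- propositions; every derivable list is nonempty (axioms are singletons and
  -- no rule shrinks a list to empty).
  infix 4 ⊢_
  data ⊢_ : List (Cond A) → Set where
    prop  : ∀ {X} → PropAxiom X → ⊢ [ X ]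
    kAx   : ∀ X Y Z → ⊢ [ (⟦ X ⟧ (Y ⇒ Z)) ⇒ ((⟦ X ⟧ Y) ⇒ (⟦ X ⟧ Z)) ]
    tAx   : ∀ X Y → ⊢ [ (⟦ X ⟧ Y) ⇒ (X ⇒ Y) ]
    negAx : ∀ X Y → ⊢ [ (⟦ X ⟧ (¬c Y)) ⇔ (¬c (⟦ X ⟧ Y)) ]
    mp    : ∀ Γ Δ X Y → ⊢ Γ ++ [ X ] → ⊢ Δ ++ [ X ⇒ Y ] → ⊢ Γ ++ Δ ++ [ Y ]
    perm  : ∀ {Γ Δ} → Γ ↭ Δ → ⊢ Γ → ⊢ Δ
    contr : ∀ Γ X → ⊢ Γ ++ X ∷ X ∷ [] → ⊢ Γ ++ [ X ]
    weak  : ∀ G Γ X → ⊢ G ∷ Γ → ⊢ (G ∷ Γ) ++ [ X ]   -- ⌊Γ⌋ needs n ≥ 1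
    cond  : ∀ Γ X Y → ⊢ Γ ++ [ X ⇒ Y ] → ⊢ Γ ++ (¬c X) ∷ (⟦ X ⟧ Y) ∷ []
    repl  : ∀ Γ X Y Z → ⊢ Γ ++ [ Y ⇔ (¬c X) ] → ⊢ Γ ++ [ (⟦ X ⟧ Z) ⇔ Z ]
          → ⊢ Γ ++ [ (⟦ Y ⟧ Z) ⇔ Z ]

-- The theorem combines monotonicity in Y and congruence in W in both directions.
module Submission where

open import Defs
open import Data.List using (List; []; _∷_; _++_; [_])
open import Data.List.Properties using (++-assoc; ++-identityʳ)
open import Data.List.Relation.Binary.Permutation.Propositional
  using (_↭_; ↭-prep; ↭-swap; ↭-refl; module PermutationReasoning)
open import Data.List.Relation.Binary.Permutation.Propositional.Properties
  using (++-comm; ++⁺ˡ; shift)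
open import Data.List.Membership.Propositional using (_∈_)
open import Data.List.Relation.Unary.Any using (here; there)
open import Relation.Binary.PropositionalEquality using (refl; subst; sym)

module _ {A : Set} where

  private
    C : Set
    C = Cond A

  ⊢⌊_∣_⌋ : List C → C → Set
  ⊢⌊ Θ ∣ P ⌋ = ⊢ Θ ++ [ P ]

  addComponent : ∀ Θ (N : C) {P} → ⊢⌊ Θ ∣ P ⌋ → ⊢⌊ Θ ++ [ N ] ∣ P ⌋
  addComponent Θ N {P} d =
    perm (++-comm [ P ] (Θ ++ [ N ])) (weak P Θ N (perm (++-comm Θ [ P ]) d))

  weaken : ∀ Θ Δ {P : C} → ⊢⌊ Θ ∣ P ⌋ → ⊢⌊ Θ ++ Δ ∣ P ⌋
  weaken Θ [] {P} d = subst (λ Θ′ → ⊢⌊ Θ′ ∣ P ⌋) (sym (++-identityʳ Θ)) d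
  weaken Θ (N ∷ Δ) {P} d =
    subst (λ Θ′ → ⊢⌊ Θ′ ∣ P ⌋) (++-assoc Θ [ N ] Δ) (weaken (Θ ++ [ N ]) Δ (addComponent Θ N d))

  lift : ∀ Θ {P : C} → ⊢ [ P ] → ⊢⌊ Θ ∣ P ⌋
  lift Θ = weaken [] Θ

  -- A duplicated leading component can be contracted (the contraction rule
  -- only acts at the end, so move the pair there and back).
  contractHead : ∀ (G : C) L → ⊢ G ∷ G ∷ L → ⊢ G ∷ L
  contractHead G L d =
    perm (++-comm L [ G ]) (contr L G (perm (++-comm (G ∷ G ∷ []) L) d))

  -- Two copies of a context contract to one; this is what lets modus ponens,
  -- which concatenates the premises' contexts, stay inside a fixed Θ.
  contractContext : ∀ (Θ L : List C) → ⊢ Θ ++ Θ ++ L → ⊢ Θ ++ L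
  contractContext [] L d = d
  contractContext (G ∷ Θ) L d =
    perm (shift G Θ L) (contractContext Θ (G ∷ L) (perm moveG oneG))
    where
    open PermutationReasoning
    pairG : G ∷ Θ ++ G ∷ Θ ++ L ↭ G ∷ G ∷ Θ ++ Θ ++ L
    pairG = ↭-prep G (shift G Θ (Θ ++ L))
    oneG : ⊢ G ∷ Θ ++ Θ ++ L
    oneG = contractHead G (Θ ++ Θ ++ L) (perm pairG d)
    moveG : G ∷ Θ ++ Θ ++ L ↭ Θ ++ Θ ++ G ∷ L
    moveG = begin
      G ∷ Θ ++ Θ ++ L   ↭⟨ shift G Θ (Θ ++ L) ⟨
      Θ ++ G ∷ Θ ++ L   ↭⟨ ++⁺ˡ Θ (shift G Θ L) ⟨
      Θ ++ Θ ++ G ∷ L   ∎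

  mpUnder : ∀ Θ {P Q : C} → ⊢⌊ Θ ∣ P ⌋ → ⊢⌊ Θ ∣ P ⇒ Q ⌋ → ⊢⌊ Θ ∣ Q ⌋
  mpUnder Θ {P} {Q} p f = contractContext Θ [ Q ] (mp Θ Θ P Q p f)

  -- If K follows with an extra last component N, and N (next to K) yields K,
  -- then K holds outright: exchange N and K, derive a second K, contract.
  discharge : ∀ Θ {N K : C} → ⊢⌊ Θ ++ [ N ] ∣ K ⌋
    → (⊢⌊ Θ ++ [ K ] ∣ N ⌋ → ⊢⌊ Θ ++ [ K ] ∣ K ⌋) → ⊢⌊ Θ ∣ K ⌋
  discharge Θ {N} {K} d fromN =
    contr Θ K (subst ⊢_ (++-assoc Θ [ K ] [ K ]) (fromN (perm exchange d)))
    where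
    open PermutationReasoning
    exchange : (Θ ++ [ N ]) ++ [ K ] ↭ (Θ ++ [ K ]) ++ [ N ]
    exchange = begin
      (Θ ++ [ N ]) ++ [ K ]   ≡⟨ ++-assoc Θ [ N ] [ K ] ⟩
      Θ ++ N ∷ K ∷ []         ↭⟨ ++⁺ˡ Θ (↭-swap N K ↭-refl) ⟩
      Θ ++ K ∷ N ∷ []         ≡⟨ ++-assoc Θ [ K ] [ N ] ⟨
      (Θ ++ [ K ]) ++ [ N ]   ∎

  conditionalise : ∀ Θ {X Y Z : C} → ⊢⌊ Θ ∣ X ⇒ (Y ⇒ Z) ⌋
    → ⊢⌊ Θ ++ [ ¬c X ] ∣ (⟦ X ⟧ Y) ⇒ (⟦ X ⟧ Z) ⌋
  conditionalise Θ {X} {Y} {Z} d =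
    mpUnder (Θ ++ [ ¬c X ]) conditioned (lift (Θ ++ [ ¬c X ]) (kAx X Y Z))
    where
    conditioned : ⊢⌊ Θ ++ [ ¬c X ] ∣ ⟦ X ⟧ (Y ⇒ Z) ⌋
    conditioned = subst ⊢_ (sym (++-assoc Θ [ ¬c X ] [ ⟦ X ⟧ (Y ⇒ Z) ])) (cond Θ X (Y ⇒ Z) d)

  -- Logical layer: natural deduction over the facts holding under Θ, with a
  -- list Hs of discharged hypotheses.
  infixl 9 _·_
  infix 3 _⨾_⊩_
  data _⨾_⊩_ (Θ Hs : List C) : C → Set where
    hyp  : ∀ {P} → P ∈ Hs → Θ ⨾ Hs ⊩ P
    fact : ∀ {P} → ⊢⌊ Θ ∣ P ⌋ → Θ ⨾ Hs ⊩ P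
    _·_  : ∀ {P Q} → Θ ⨾ Hs ⊩ P ⇒ Q → Θ ⨾ Hs ⊩ P → Θ ⨾ Hs ⊩ Q

  variable
    Θ Hs : List C
    P Q R U W X Y Z : C

  axiom : ⊢ [ P ] → Θ ⨾ Hs ⊩ P
  axiom {Θ = Θ} t = fact (lift Θ t)

  lam : Θ ⨾ P ∷ Hs ⊩ Q → Θ ⨾ Hs ⊩ P ⇒ Q
  lam {P = P} (hyp (here refl)) =
    axiom (prop (ax-S P (P ⇒ P) P)) · axiom (prop (ax-K P (P ⇒ P))) · axiom (prop (ax-K P P))
  lam (hyp (there i)) = axiom (prop (ax-K _ _)) · hyp i
  lam (fact d)        = axiom (prop (ax-K _ _)) · fact d
  lam (f · a)         = axiom (prop (ax-S _ _ _)) · lam f · lam a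

  close : Θ ⨾ [] ⊩ P → ⊢⌊ Θ ∣ P ⌋
  close (hyp ())
  close (fact d)        = d
  close {Θ = Θ} (f · a) = mpUnder Θ (close a) (close f)

  wk : Θ ⨾ Hs ⊩ P → Θ ⨾ Q ∷ Hs ⊩ P
  wk (hyp i)  = hyp (there i)
  wk (fact d) = fact d
  wk (f · a)  = wk f · wk a

  v0 : Θ ⨾ P ∷ Hs ⊩ P
  v0 = hyp (here refl)

  v1 : Θ ⨾ Q ∷ P ∷ Hs ⊩ P
  v1 = hyp (there (here refl))

  v2 : Θ ⨾ R ∷ Q ∷ P ∷ Hs ⊩ P
  v2 = hyp (there (there (here refl)))

  top : Θ ⨾ Hs ⊩ ⊤c
  top = lam v0

  efq : Θ ⨾ Hs ⊩ ⊥c ⇒ P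
  efq {P = P} = lam (axiom (prop (ax-C P ⊤c)) · lam (lam v2) · top)

  dne : Θ ⨾ Hs ⊩ ¬c (¬c P) ⇒ P
  dne {P = P} = lam (axiom (prop (ax-C P (¬c (¬c P)))) · lam (lam (v0 · v1)) · v0)

  andI : Θ ⨾ Hs ⊩ P → Θ ⨾ Hs ⊩ Q → Θ ⨾ Hs ⊩ P ∧c Q
  andI p q = lam ((v0 · lam (v0 · wk (wk p))) · wk q)

  andE₁ : Θ ⨾ Hs ⊩ P ∧c Q → Θ ⨾ Hs ⊩ P
  andE₁ c = dne · lam (wk c · lam (efq · (v0 · v1)))

  andE₂ : Θ ⨾ Hs ⊩ P ∧c Q → Θ ⨾ Hs ⊩ Q
  andE₂ c = dne · lam (wk c · lam v1)

  iffI : Θ ⨾ P ∷ Hs ⊩ Q → Θ ⨾ Q ∷ Hs ⊩ P → Θ ⨾ Hs ⊩ P ⇔ Q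
  iffI pq qp = andI (lam pq) (lam qp)

  iffE₁ : Θ ⨾ Hs ⊩ P ⇔ Q → Θ ⨾ Hs ⊩ P → Θ ⨾ Hs ⊩ Q
  iffE₁ e p = andE₁ e · p

  iffE₂ : Θ ⨾ Hs ⊩ P ⇔ Q → Θ ⨾ Hs ⊩ Q → Θ ⨾ Hs ⊩ P
  iffE₂ e q = andE₂ e · q

  iffSym : Θ ⨾ Hs ⊩ P ⇔ Q → Θ ⨾ Hs ⊩ Q ⇔ P
  iffSym e = andI (andE₂ e) (andE₁ e)

  condT : Θ ⨾ Hs ⊩ ⟦ X ⟧ Y → Θ ⨾ Hs ⊩ X → Θ ⨾ Hs ⊩ Y
  condT {X = X} {Y = Y} c x = axiom (tAx X Y) · c · x

  negIn : Θ ⨾ Hs ⊩ ¬c (⟦ X ⟧ Y) → Θ ⨾ Hs ⊩ ⟦ X ⟧ (¬c Y)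
  negIn {X = X} {Y = Y} = iffE₂ (axiom (negAx X Y))

  negOut : Θ ⨾ Hs ⊩ ⟦ X ⟧ (¬c Y) → Θ ⨾ Hs ⊩ ¬c (⟦ X ⟧ Y)
  negOut {X = X} {Y = Y} = iffE₁ (axiom (negAx X Y))

  trueCondition : ⊢⌊ Θ ∣ (⟦ ⊤c ⟧ U) ⇔ U ⌋
  trueCondition = close (iffI (condT v0 top)
                              (dne · lam (condT (negIn v0) top · v1)))

  -- Conditioning on a false proposition is vacuous: from ⌊Θ|¬W⌋, [W]U ↔ U.
  -- (Replace ⊤ by W, which is equivalent to ¬⊤.)
  falseCondition : ⊢⌊ Θ ∣ ¬c W ⌋ → ⊢⌊ Θ ∣ (⟦ W ⟧ U) ⇔ U ⌋
  falseCondition {Θ = Θ} {W = W} {U = U} notW =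
    repl Θ ⊤c W U (close (iffI (efq · (fact notW · v0)) (efq · (v0 · top)))) trueCondition

  -- The replacement rule for an equivalent rather than a negated condition,
  -- obtained by applying `repl` twice (W ↦ ¬W ↦ X).
  replEquiv : ⊢⌊ Θ ∣ X ⇔ W ⌋ → ⊢⌊ Θ ∣ (⟦ W ⟧ U) ⇔ U ⌋ → ⊢⌊ Θ ∣ (⟦ X ⟧ U) ⇔ U ⌋
  replEquiv {Θ = Θ} {X = X} {W = W} {U = U} xw wU =
    repl Θ (¬c W) X U (close (iffI (lam (v0 · iffE₁ (fact xw) v1))
                                   (iffE₂ (fact xw) (dne · v0))))
      (repl Θ W (¬c W) U (close (iffI v0 v0)) wU)

  condMono : ⊢⌊ Θ ∣ Y ⇒ Z ⌋ → ⊢⌊ Θ ∣ (⟦ W ⟧ Y) ⇒ (⟦ W ⟧ Z) ⌋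
  condMono {Θ = Θ} {Y = Y} {Z = Z} {W = W} yz =
    discharge Θ (conditionalise Θ (close (lam (fact yz)))) fromNotW
    where
    K : C
    K = (⟦ W ⟧ Y) ⇒ (⟦ W ⟧ Z)
    fromNotW : ⊢⌊ Θ ++ [ K ] ∣ ¬c W ⌋ → ⊢⌊ Θ ++ [ K ] ∣ K ⌋
    fromNotW notW = close (lam (iffE₂ (fact (falseCondition notW))
                               (fact (addComponent Θ K yz) · iffE₁ (fact (falseCondition notW)) v0)))

  -- Idempotence of conditioning: [W][W]Z ↔ [W]Z.  Under ¬W, the K axiom turns
  -- [W]V → (W → V) and [W]¬V ↔ ¬[W]V into statements about nested conditionals.
  condIdem : ∀ Θ {W Z : C} → ⊢⌊ Θ ∣ (⟦ W ⟧ (⟦ W ⟧ Z)) ⇔ (⟦ W ⟧ Z) ⌋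
  condIdem Θ {W} {Z} = discharge Θ underNotW falseCondition
    where
    flatten : ∀ V → ⊢⌊ Θ ++ [ ¬c W ] ∣ (⟦ W ⟧ (⟦ W ⟧ V)) ⇒ (⟦ W ⟧ V) ⌋
    flatten V = conditionalise Θ (close (lam (lam (condT v0 v1))))
    pushNeg : ⊢⌊ Θ ++ [ ¬c W ] ∣ (⟦ W ⟧ (¬c (⟦ W ⟧ Z))) ⇒ (⟦ W ⟧ (⟦ W ⟧ (¬c Z))) ⌋
    pushNeg = conditionalise Θ (close (lam (lam (negIn v0))))
    underNotW : ⊢⌊ Θ ++ [ ¬c W ] ∣ (⟦ W ⟧ (⟦ W ⟧ Z)) ⇔ (⟦ W ⟧ Z) ⌋
    underNotW = close (iffI (fact (flatten Z) · v0)
      (dne · lam (negOut (fact (flatten (¬c Z)) · (fact pushNeg · negIn v0)) · v1)))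

  -- Under ¬X,
  -- [X]([W]Z → Z) gives [X][W]Z → [X]Z, and [X][W]Z ↔ [W]Z by replEquiv and
  -- condIdem; ¬X, hence ¬W, makes the goal trivial.
  condCong : ⊢⌊ Θ ∣ W ⇔ X ⌋ → ⊢⌊ Θ ∣ (⟦ W ⟧ Z) ⇒ (⟦ X ⟧ Z) ⌋
  condCong {Θ = Θ} {W = W} {X = X} {Z = Z} wx = discharge Θ underNotX fromNotX
    where
    K : C
    K = (⟦ W ⟧ Z) ⇒ (⟦ X ⟧ Z)
    absorb : ⊢⌊ Θ ∣ (⟦ X ⟧ (⟦ W ⟧ Z)) ⇔ (⟦ W ⟧ Z) ⌋
    absorb = replEquiv (close (iffSym (fact wx))) (condIdem Θ)
    underNotX : ⊢⌊ Θ ++ [ ¬c X ] ∣ K ⌋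
    underNotX = close (lam (fact (conditionalise Θ (close (lam (lam (condT v0 (iffE₂ (fact wx) v1))))))
                            · iffE₂ (fact (addComponent Θ (¬c X) absorb)) v0))
    fromNotX : ⊢⌊ Θ ++ [ K ] ∣ ¬c X ⌋ → ⊢⌊ Θ ++ [ K ] ∣ K ⌋
    fromNotX notX = close (lam (iffE₂ (fact (falseCondition notX))
                                      (iffE₁ (fact (falseCondition notW)) v0)))
      where
      notW : ⊢⌊ Θ ++ [ K ] ∣ ¬c W ⌋
      notW = close (lam (fact notX · iffE₁ (fact (addComponent Θ K wx)) v0))

mainTheorem19 : {A : Set} (Γ : List (Cond A)) (W X Y Z : Cond A)
    → ⊢ Γ ++ [ W ⇔ X ] → ⊢ Γ ++ [ Y ⇔ Z ]
    → ⊢ Γ ++ [ (⟦ W ⟧ Y) ⇔ (⟦ X ⟧ Z) ]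
mainTheorem19 Γ W X Y Z wx yz = close (iffI
    (fact (condCong wx) · (fact (condMono (close (lam (iffE₁ (fact yz) v0)))) · v0))
    (fact (condCong (close (iffSym (fact wx)))) · (fact (condMono (close (lam (iffE₂ (fact yz) v0)))) · v0)))
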